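{- Fix $t\in[0,\infty]$. Define $\mathcal{R}_t$ on out-ordered digraphs by $\mathcal{R}_t(S,\Gamma,\preceq)=(S,\sim_t)$, where $x\sim_t y$ if and only if $x=y$ or $x$ and $y$ are joined by a path in the graph $(S,\mathcal{L}_t)$. Define $\mathcal{R}_t$ on neighborhood-ordinal injections by $\mathcal{R}_t(\iota)=\iota$. Then $\mathcal{R}_t$ (rank-based linkage with cut-off $t$) is a functor from the category of out-ordered digraphs with neighborhood-ordinal injections to the category of partitioned sets. In particular, for every neighborhood-ordinal injection $\iota:(S,\Gamma,\preceq)\to(S',\Gamma',\preceq')$ and all $x,y\in S$, if $x\sim_t y$ in $\mathcal{R}_t(S,\Gamma,\preceq)$ then $\iota(x)\sim_t\iota(y)$ in $\mathcal{R}_t(S',\Gamma',\preceq')$.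
   Context: Out-ordered digraphs. An out-ordered digraph is $(S,\Gamma,\preceq)$ where: - $S$ is a set; - $\Gamma:S\to\mathcal{P}(S)$ is a function; - $\preceq_x$ is a partial order on $\Gamma(x)$ for each $x$. We write $\prec_x$ for its strict part. Neighborhood-ordinal injections. A neighborhood-ordinal injection $\iota:(S,\Gamma,\preceq)\to(S',\Gamma',\preceq')$ is an injective map $\iota:S\to S'$ such that: - $y\in\Gamma(x)$ implies $\iota(y)\in\Gamma'(\iota(x))$; - $y\preceq_x z$ implies $\iota(y)\preceq'_{\iota(x)}\iota(z)$; - for all $x$ and $w\in\Gamma'(\iota(x))\setminus\iota(\Gamma(x))$, we have $\iota(y)\prec'_{\iota(x)}w$ for all $y\in\Gamma(x)$. Mutual friends. $x,z$ are mutual friends if $z\in\Gamma(x)$ and $x\in\Gamma(z)$. Third-wheels. $$\mathscr{F}(x,z)=\{y: x,z\in\Gamma(y)\}\cup\{y: y\in\Gamma(x),z\in\Gamma(y)\}\cup\{y: x\in\Gamma(y),y\in\Gamma(z)\}.$$ In-sway. For mutual friends $x,z$, the in-sway is $\sigma(\{x,z\})=\operatorname{card}\{y\in\mathscr{F}(x,z): (y\in\Gamma(x)\Rightarrow z\prec_x y)\text{ and }(y\in\Gamma(z)\Rightarrow x\prec_z y)\}$. Cut-off graph. $\mathcal{L}_t$ is the set of pairs $\{x,z\}$ of mutual friends with $\sigma(\{x,z\})\ge t$. Partitioned sets. A partitioned set is a set with an equivalence relation. Morphisms of partitioned sets are functions preserving the relation. -}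

module Defs where

open import Data.Nat using (ℕ)
open import Data.Fin using (Fin)
open import Data.Product using (Σ; ∃; _×_; _,_)
open import Data.Sum using (_⊎_)
open import Relation.Binary.PropositionalEquality using (_≡_; _≢_)
open import Relation.Nullary using (¬_)
open import Function.Definitions using (Injective)
open import Relation.Binary.Construct.Closure.ReflexiveTransitive using (Star)

-- An out-ordered digraph (S, Γ, ⪯).
--   Γ x y        : y ∈ Γ(x)
--   y ⪯[ x ] z   : y ⪯_x z, a partial order on Γ(x)
--                  (modelled as a relation on S supported on Γ(x)).
record OutOrderedDigraph : Set₁ where
  field
    S        : Set
    Γ        : S → S → Set
    _⪯[_]_   : S → S → S → Set
    ⪯-supp   : ∀ {x y z} → y ⪯[ x ] z → Γ x y × Γ x z
    ⪯-refl   : ∀ {x y} → Γ x y → y ⪯[ x ] y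
    ⪯-antisym : ∀ {x y z} → y ⪯[ x ] z → z ⪯[ x ] y → y ≡ z
    ⪯-trans  : ∀ {x y z w} → y ⪯[ x ] z → z ⪯[ x ] w → y ⪯[ x ] w

  _≺[_]_ : S → S → S → Set
  y ≺[ x ] z = (y ⪯[ x ] z) × (y ≢ z)

  MutualFriends : S → S → Set
  MutualFriends x z = Γ x z × Γ z x

  ThirdWheel : S → S → S → Set
  ThirdWheel x z y =
    (Γ y x × Γ y z) ⊎ ((Γ x y × Γ y z) ⊎ (Γ y x × Γ z y))

  InSway : S → S → S → Set
  InSway x z y =
    ThirdWheel x z y × ((Γ x y → z ≺[ x ] y) × (Γ z y → x ≺[ z ] y))

open OutOrderedDigraph public

AtLeast : {A : Set} → ℕ → (A → Set) → Set
AtLeast {A} n P = Σ (Fin n → A) λ g → Injective _≡_ _≡_ g × (∀ i → P (g i))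

-- cut-off t ∈ [0,∞]; since σ is a cardinal, σ ≥ t only depends on ⌈t⌉ ∈ ℕ ∪ {∞}
data Cutoff : Set where
  fin : ℕ → Cutoff
  ∞   : Cutoff

CardGE : {A : Set} → (A → Set) → Cutoff → Set
CardGE P (fin n) = AtLeast n P
CardGE P ∞       = ∀ n → AtLeast n P

Linked : Cutoff → (G : OutOrderedDigraph) → S G → S G → Set
Linked t G x z = MutualFriends G x z × CardGE (InSway G x z) t

Related : Cutoff → (G : OutOrderedDigraph) → S G → S G → Set
Related t G = Star (λ a b → Linked t G a b ⊎ Linked t G b a)

record NOI (G H : OutOrderedDigraph) : Set where
  field
    map     : S G → S H
    inj     : Injective _≡_ _≡_ map
    pres-Γ  : ∀ {x y} → Γ G x y → Γ H (map x) (map y)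
    pres-⪯  : ∀ {x y z} → _⪯[_]_ G y x z → _⪯[_]_ H (map y) (map x) (map z)
    new-top : ∀ {x w} → Γ H (map x) w → ¬ (∃ λ y → Γ G x y × map y ≡ w) →
              ∀ {y} → Γ G x y → _≺[_]_ H (map y) (map x) w

open NOI public

-- An injection ι preserves adjacency and the neighbourhood orders, and places every new
-- out-neighbour of ι x above all the old ones; hence each y in the in-sway of {x, z}
-- lands in the in-sway of {ι x, ι z}, and by injectivity σ can only grow. So ι maps
-- 𝓛_t-edges to 𝓛_t-edges, hence 𝓛_t-paths to 𝓛_t-paths.
module Submission where

open import Defs
open import Level using (0ℓ)
open import Function using (_∘_)
open import Function.Definitions using (Injective)
open import Data.Product using (_×_; _,_; ∃)
open import Data.Sum as Sum using (inj₁; inj₂)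
open import Axiom.ExcludedMiddle using (ExcludedMiddle)
open import Relation.Binary.Structures using (IsEquivalence)
open import Relation.Binary.Construct.Closure.ReflexiveTransitive using (ε; _◅◅_; gmap; reverse)
open import Relation.Binary.PropositionalEquality using (_≡_; subst)
open import Relation.Nullary using (¬_; yes; no)

Related-isEquivalence : ∀ t G → IsEquivalence (Related t G)
Related-isEquivalence t G = record
  { refl  = ε
  ; sym   = reverse Sum.swap
  ; trans = _◅◅_
  }

AtLeast-map : ∀ {A B : Set} {P : A → Set} {Q : B → Set} {n} (f : A → B) →
              Injective _≡_ _≡_ f → (∀ {a} → P a → Q (f a)) → AtLeast n P → AtLeast n Q
AtLeast-map f f-inj P⇒Q (g , g-inj , Pg) = f ∘ g , g-inj ∘ f-inj , λ i → P⇒Q (Pg i)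

CardGE-map : ∀ {A B : Set} {P : A → Set} {Q : B → Set} (f : A → B) →
             Injective _≡_ _≡_ f → (∀ {a} → P a → Q (f a)) →
             ∀ t → CardGE P t → CardGE Q t
CardGE-map {P = P} {Q} f f-inj P⇒Q (fin n) = AtLeast-map {P = P} {Q} f f-inj P⇒Q
CardGE-map {P = P} {Q} f f-inj P⇒Q ∞ P∞ n  = AtLeast-map {P = P} {Q} f f-inj P⇒Q (P∞ n)

module _ {G H : OutOrderedDigraph} (ι : NOI G H) where

  ThirdWheel-map : ∀ {x z y} → ThirdWheel G x z y →
                   ThirdWheel H (map ι x) (map ι z) (map ι y)
  ThirdWheel-map (inj₁ (yx , yz))        = inj₁ (pres-Γ ι yx , pres-Γ ι yz)
  ThirdWheel-map (inj₂ (inj₁ (xy , yz))) = inj₂ (inj₁ (pres-Γ ι xy , pres-Γ ι yz))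
  ThirdWheel-map (inj₂ (inj₂ (yx , zy))) = inj₂ (inj₂ (pres-Γ ι yx , pres-Γ ι zy))

  -- Excluded middle decides whether ι c is an old out-neighbour of ι a (then the order
  -- is transported) or a new one (then it lies above everything old, in particular ι b).
  ≺-above-map : ExcludedMiddle 0ℓ → ∀ {a b c} → Γ G a b →
                (Γ G a c → _≺[_]_ G b a c) →
                Γ H (map ι a) (map ι c) → _≺[_]_ H (map ι b) (map ι a) (map ι c)
  ≺-above-map em {a} {b} {c} ab old⇒≺ ιaιc with em {Γ G a c}
  ... | yes ac = let (b⪯c , b≢c) = old⇒≺ ac in pres-⪯ ι b⪯c , b≢c ∘ inj ι
  ... | no ¬ac = new-top ι ιaιc not-image ab
    where
    not-image : ¬ (∃ λ c′ → Γ G a c′ × map ι c′ ≡ map ι c)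
    not-image (c′ , ac′ , ιc′≡ιc) = ¬ac (subst (Γ G a) (inj ι ιc′≡ιc) ac′)

  InSway-map : ExcludedMiddle 0ℓ → ∀ {x z y} → MutualFriends G x z →
               InSway G x z y → InSway H (map ι x) (map ι z) (map ι y)
  InSway-map em (xz , zx) (wheel , x-cond , z-cond) =
    ThirdWheel-map wheel , ≺-above-map em xz x-cond , ≺-above-map em zx z-cond

  Linked-map : ExcludedMiddle 0ℓ → ∀ t {x z} →
               Linked t G x z → Linked t H (map ι x) (map ι z)
  Linked-map em t ((xz , zx) , sway) =
    (pres-Γ ι xz , pres-Γ ι zx) , CardGE-map (map ι) (inj ι) (InSway-map em (xz , zx)) t sway

  Related-map : ExcludedMiddle 0ℓ → ∀ t {x y} →
                Related t G x y → Related t H (map ι x) (map ι y)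
  Related-map em t = gmap (map ι) (Sum.map (Linked-map em t) (Linked-map em t))

theorem5p31 : ExcludedMiddle 0ℓ → (t : Cutoff) →
    ((G : OutOrderedDigraph) → IsEquivalence (Related t G)) ×
    ((G H : OutOrderedDigraph) (ι : NOI G H) (x y : S G) →
      Related t G x y → Related t H (map ι x) (map ι y))
theorem5p31 em t = Related-isEquivalence t , λ G H ι x y → Related-map ι em t
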